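{- Define integers $P(n,k)$ for integers $0\le k\le n$ by $P(n,0)=2^n-1$, $P(n,n)=2^{n-2}n(n-1)+2^n-1$ for $n\ge1$ (and $P(0,0)=0$), and for $0<k<n$: $P(n,k)=P(n-1,k)+P(n-1,k-1)+k2^{k-1}+2^{n-1}$. Define $B(n,k)=2^{n-2}k^2+2^{n-2}k+2^{n+1}-2^{k-1}k-2^k-2^{n-k}$. Then for all integers $0\le k<n$, $P(n,k)\le B(n,k)$.
   Context: $P(n,k)$ is the number of comparators of the Pairwise Half-Bitonic Selection Network selecting the $2^k$ largest of $2^n$ inputs, and $B(n,k)$ is the number of comparators of the Bitonic Selection Network with the same parameters; the claim is the purely arithmetic inequality above. -}

module Defs where

open import Data.Nat using (ℕ; zero; suc; _+_; _*_; _∸_; _^_; _/_)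
open import Data.Nat.Properties using (<-cmp)
open import Relation.Binary.Definitions using (tri<; tri≈; tri>)
open import Data.Integer as ℤ using (ℤ; +_; _-_)

-- pow2m2 n x  represents  2^(n-2) * x.  For n ∈ {0,1} we use floor
-- division; in every place it is used below (n ≥ 1 and x even, or x = 0)
-- the division is exact, so this agrees with the rational value 2^(n-2)·x.
pow2m2 : ℕ → ℕ → ℕ
pow2m2 (suc (suc m)) x = 2 ^ m * x
pow2m2 (suc zero)    x = x / 2
pow2m2 zero          x = x / 4

-- kpow k represents 2^(k-1) * k  (equal to 0 for k = 0).
kpow : ℕ → ℕ
kpow zero    = 0
kpow (suc j) = 2 ^ j * suc j

-- P(n,k): comparators of the Pairwise Half-Bitonic Selection Network.
-- Meaningful for 0 ≤ k ≤ n; out-of-range values (k > n) are set to 0.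
--   P(n,0) = 2^n - 1
--   P(n,n) = 2^(n-2) n (n-1) + 2^n - 1   (n ≥ 1)
--   P(n,k) = P(n-1,k) + P(n-1,k-1) + k 2^(k-1) + 2^(n-1)   (0 < k < n)
P : ℕ → ℕ → ℕ
P n       zero    = 2 ^ n ∸ 1
P zero    (suc k) = 0
P (suc n) (suc k) with <-cmp k n
... | tri< _ _ _ = P n (suc k) + P n k + kpow (suc k) + 2 ^ n
... | tri≈ _ _ _ = pow2m2 (suc n) (suc n * n) + 2 ^ suc n ∸ 1
... | tri> _ _ _ = 0

-- B(n,k) = 2^(n-2) k^2 + 2^(n-2) k + 2^(n+1) - 2^(k-1) k - 2^k - 2^(n-k)
-- (used for k < n, so n - k is a genuine natural-number difference).
B : ℕ → ℕ → ℤ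
B n k = + pow2m2 n (k * k + k) ℤ.+ + (2 ^ (n + 1))
        - + kpow k - + (2 ^ k) - + (2 ^ (n ∸ k))

-- The bound extends to all 0 ≤ k ≤ n and is tight on both edges k = 0 and
-- k = n, so it can be proved by induction along the recurrence of P. In the
-- step P(n+1,k+1) with n = k + 1 + d, adding the bounds for P(n,k+1) and P(n,k)
-- and the extra cost leaves a slack of 2^(k+d) (k-1) + 2^d - k 2^(k-1) below
-- B(n+1,k+1). It is 0 at k = 0, 2^d - 1 at k = 1, and nonnegative for k ≥ 2
-- since 2^(k+d) (k-1) ≥ 2^k (k-1) ≥ k 2^(k-1).
module Submission where

open import Defs
open import Data.Nat using (ℕ; _<_; zero; suc; _+_; _*_; _∸_; _^_; _/_; s≤s)
  renaming (_≤_ to _≤ₙ_)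
open import Data.Integer using (+_; _≤_)
open import Data.Nat.Properties
open import Data.Nat.DivMod using (m*n/n≡m)
open import Data.Nat.Tactic.RingSolver using (solve-∀)
open import Data.Product using (_,_)
open import Relation.Binary.PropositionalEquality
open import Relation.Binary.Definitions using (tri<; tri≈; tri>)
open import Relation.Nullary using (contradiction)
import Data.Integer as ℤ
import Data.Integer.Properties as ℤ
import Data.Integer.Tactic.RingSolver as ℤSolver

triangle : ℕ → ℕ
triangle zero    = 0
triangle (suc k) = suc k + triangle k

k*k+k≡2*triangle : ∀ k → k * k + k ≡ 2 * triangle k
k*k+k≡2*triangle zero    = refl
k*k+k≡2*triangle (suc k) = begin
  suc k * suc k + suc k             ≡⟨ expand k ⟩
  2 * suc k + (k * k + k)           ≡⟨ cong (_+_ (2 * suc k)) (k*k+k≡2*triangle k) ⟩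
  2 * suc k + 2 * triangle k        ≡⟨ *-distribˡ-+ 2 (suc k) (triangle k) ⟨
  2 * triangle (suc k)              ∎
  where
  open ≡-Reasoning
  expand : ∀ k → (1 + k) * (1 + k) + (1 + k) ≡ 2 * (1 + k) + (k * k + k)
  expand = solve-∀

pow2m2-double : ∀ j t → pow2m2 (suc j) (2 * t) ≡ 2 ^ j * t
pow2m2-double zero    t = trans (cong (_/ 2) (*-comm 2 t)) (trans (m*n/n≡m t 2) (sym (*-identityˡ t)))
pow2m2-double (suc i) t = trans (sym (*-assoc (2 ^ i) 2 t)) (cong (_* t) (*-comm (2 ^ i) 2))

pow2m2-zero : ∀ n → pow2m2 n 0 ≡ 0
pow2m2-zero zero          = refl
pow2m2-zero (suc zero)    = refl
pow2m2-zero (suc (suc m)) = *-zeroʳ (2 ^ m)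

B⁺ B⁻ : ℕ → ℕ → ℕ
B⁺ n k = pow2m2 n (k * k + k) + 2 ^ suc n
B⁻ n k = kpow k + 2 ^ k + 2 ^ (n ∸ k)

B⁺-suc : ∀ j k → B⁺ (suc j) k ≡ 2 ^ j * (triangle k + 4)
B⁺-suc j k = begin
  pow2m2 (suc j) (k * k + k) + 2 ^ suc (suc j)
    ≡⟨ cong (λ x → pow2m2 (suc j) x + 2 ^ suc (suc j)) (k*k+k≡2*triangle k) ⟩
  pow2m2 (suc j) (2 * triangle k) + 2 ^ suc (suc j)
    ≡⟨ cong (_+ 2 ^ suc (suc j)) (pow2m2-double j (triangle k)) ⟩
  2 ^ j * triangle k + 2 * (2 * 2 ^ j)
    ≡⟨ factor (2 ^ j) (triangle k) ⟩
  2 ^ j * (triangle k + 4) ∎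
  where
  open ≡-Reasoning
  factor : ∀ a t → a * t + 2 * (2 * a) ≡ a * (t + 4)
  factor = solve-∀

B⁻-offset : ∀ k d {n} → k + d ≡ n → B⁻ n k ≡ kpow k + 2 ^ k + 2 ^ d
B⁻-offset k d refl = cong (λ e → kpow k + 2 ^ k + 2 ^ e) (m+n∸m≡n k d)

m∸1+suc[n]≡m+n : ∀ {m} n → 0 < m → m ∸ 1 + suc n ≡ m + n
m∸1+suc[n]≡m+n {suc m} n _ = +-suc m n

left-edge : ∀ n → P n 0 + B⁻ n 0 ≡ B⁺ n 0
left-edge n = begin
  2 ^ n ∸ 1 + suc (2 ^ n)      ≡⟨ m∸1+suc[n]≡m+n (2 ^ n) (m^n>0 2 n) ⟩
  2 ^ n + 2 ^ n                ≡⟨ cong (_+_ (2 ^ n)) (+-identityʳ (2 ^ n)) ⟨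
  2 ^ suc n                    ≡⟨ cong (_+ 2 ^ suc n) (pow2m2-zero n) ⟨
  pow2m2 n 0 + 2 ^ suc n       ∎
  where open ≡-Reasoning

-- Stated for the diagonal clause of P directly: P (suc m) (suc m) does not reduce for a variable m.
diagonal-edge : ∀ m → pow2m2 (suc m) (suc m * m) + 2 ^ suc m ∸ 1 + B⁻ (suc m) (suc m) ≡ B⁺ (suc m) (suc m)
diagonal-edge m = begin
  pow2m2 (suc m) (suc m * m) + 2 * a ∸ 1 + B⁻ (suc m) (suc m)
    ≡⟨ cong₂ (λ x y → pow2m2 (suc m) x + 2 * a ∸ 1 + y)
             (trans (+-comm m (m * m)) (k*k+k≡2*triangle m)) (B⁻-offset (suc m) 0 (+-identityʳ (suc m))) ⟩
  pow2m2 (suc m) (2 * t) + 2 * a ∸ 1 + (a * suc m + 2 * a + 1)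
    ≡⟨ cong₂ (λ x y → x + 2 * a ∸ 1 + y) (pow2m2-double m t) (+-comm _ 1) ⟩
  a * t + 2 * a ∸ 1 + suc (a * suc m + 2 * a)
    ≡⟨ m∸1+suc[n]≡m+n _ (≤-trans (m^n>0 2 (suc m)) (m≤n+m (2 * a) (a * t))) ⟩
  a * t + 2 * a + (a * suc m + 2 * a)
    ≡⟨ factor a t m ⟩
  a * (triangle (suc m) + 4)
    ≡⟨ B⁺-suc m (suc m) ⟨
  B⁺ (suc m) (suc m) ∎
  where
  open ≡-Reasoning
  a = 2 ^ m
  t = triangle m
  factor : ∀ a t m → a * t + 2 * a + (a * (1 + m) + 2 * a) ≡ a * ((1 + m + t) + 4)
  factor = solve-∀

power-slack : ∀ k d → 2 ^ k * k + 2 ^ k * 2 ^ d ≤ₙ 2 ^ k * 2 ^ d * k + 2 ^ d + kpow k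
power-slack zero    d = ≤-reflexive (regroup (2 ^ d))
  where
  regroup : ∀ b → 0 + 1 * b ≡ 1 * b * 0 + b + 0
  regroup = solve-∀
power-slack (suc i) d = begin
  2 * p * suc i + 2 * p * b           ≡⟨ split p b i ⟩
  (p * i + p) + R                     ≤⟨ +-monoˡ-≤ R (+-mono-≤ pi≤pbi (p≤b+pbi i)) ⟩
  (p * b * i + (b + p * b * i)) + R   ≡⟨ merge p b i ⟩
  2 * p * b * suc i + b + p * suc i   ∎
  where
  open ≤-Reasoning
  p = 2 ^ i
  b = 2 ^ d
  R = p * i + p + 2 * p * b
  split : ∀ p b i → 2 * p * (1 + i) + 2 * p * b ≡ (p * i + p) + (p * i + p + 2 * p * b)
  split = solve-∀
  merge : ∀ p b i → (p * b * i + (b + p * b * i)) + (p * i + p + 2 * p * b) ≡ 2 * p * b * (1 + i) + b + p * (1 + i)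
  merge = solve-∀
  pi≤pbi : p * i ≤ₙ p * b * i
  pi≤pbi = *-monoˡ-≤ i (m≤m*n p b {{m^n≢0 2 d}})
  p≤b+pbi : ∀ i → 2 ^ i ≤ₙ b + 2 ^ i * b * i
  p≤b+pbi zero    = ≤-trans (m^n>0 2 d) (m≤m+n b _)
  p≤b+pbi (suc j) = ≤-trans (≤-trans (m≤m*n (2 ^ suc j) b {{m^n≢0 2 d}}) (m≤m*n _ (suc j))) (m≤n+m _ b)

recurrence-slack : ∀ {n k} → suc k ≤ₙ n →
  kpow (suc k) + 2 ^ n + B⁻ (suc n) (suc k) + B⁺ n (suc k) + B⁺ n k ≤ₙ B⁺ (suc n) (suc k) + B⁻ n (suc k) + B⁻ n k
recurrence-slack {k = k} k<n with m≤n⇒∃[o]m+o≡n k<n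
... | d , refl
  rewrite B⁻-offset (suc k) (suc d) (cong suc (+-suc k d)) | B⁻-offset (suc k) d refl | B⁻-offset k (suc d) (+-suc k d)
        | B⁺-suc (suc (k + d)) (suc k) | B⁺-suc (k + d) (suc k) | B⁺-suc (k + d) k
        | ^-distribˡ-+-* 2 k d = begin
  a * suc k + 2 * (a * b) + (a * suc k + 2 * a + 2 * b) + a * b * (suc k + t + 4) + a * b * (t + 4)
    ≡⟨ split a b k t ⟩
  (a * k + a * b) + R
    ≤⟨ +-monoˡ-≤ R (power-slack k d) ⟩
  (a * b * k + b + kpow k) + R
    ≡⟨ merge a b k t (kpow k) ⟩
  2 * (a * b) * (suc k + t + 4) + (a * suc k + 2 * a + b) + (kpow k + a + 2 * b) ∎
  where
  open ≤-Reasoning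
  a = 2 ^ k
  b = 2 ^ d
  t = triangle k
  R = a * k + 4 * a + 2 * b + a * b * k + 2 * a * b * t + 10 * a * b
  split : ∀ a b k t → a * (1 + k) + 2 * (a * b) + (a * (1 + k) + 2 * a + 2 * b) + a * b * (1 + k + t + 4) + a * b * (t + 4)
                    ≡ (a * k + a * b) + (a * k + 4 * a + 2 * b + a * b * k + 2 * a * b * t + 10 * a * b)
  split = solve-∀
  merge : ∀ a b k t q → (a * b * k + b + q) + (a * k + 4 * a + 2 * b + a * b * k + 2 * a * b * t + 10 * a * b)
                      ≡ 2 * (a * b) * (1 + k + t + 4) + (a * (1 + k) + 2 * a + b) + (q + a + 2 * b)
  merge = solve-∀

combine-bounds : ∀ {p₁ p₂ c₁ c₂ l l₁ l₂ u₁ u₂ u} → p₁ + l₁ ≤ₙ u₁ → p₂ + l₂ ≤ₙ u₂ →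
                 c₁ + c₂ + l + u₁ + u₂ ≤ₙ u + l₁ + l₂ → p₁ + p₂ + c₁ + c₂ + l ≤ₙ u
combine-bounds {p₁} {p₂} {c₁} {c₂} {l} {l₁} {l₂} {u₁} {u₂} {u} h₁ h₂ slack = +-cancelʳ-≤ (l₁ + l₂) _ _ (begin
  p₁ + p₂ + c₁ + c₂ + l + (l₁ + l₂)        ≡⟨ regroup p₁ p₂ l₁ l₂ c₁ c₂ l ⟩
  c₁ + c₂ + l + (p₁ + l₁) + (p₂ + l₂)      ≤⟨ +-mono-≤ (+-monoʳ-≤ (c₁ + c₂ + l) h₁) h₂ ⟩
  c₁ + c₂ + l + u₁ + u₂                    ≤⟨ slack ⟩
  u + l₁ + l₂                              ≡⟨ +-assoc u l₁ l₂ ⟩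
  u + (l₁ + l₂)                            ∎)
  where
  open ≤-Reasoning
  regroup : ∀ p₁ p₂ l₁ l₂ c₁ c₂ l → p₁ + p₂ + c₁ + c₂ + l + (l₁ + l₂) ≡ c₁ + c₂ + l + (p₁ + l₁) + (p₂ + l₂)
  regroup = solve-∀

P+B⁻≤B⁺ : ∀ n k → k ≤ₙ n → P n k + B⁻ n k ≤ₙ B⁺ n k
P+B⁻≤B⁺ n       zero    _         = ≤-reflexive (left-edge n)
P+B⁻≤B⁺ (suc n) (suc k) (s≤s k≤n) with <-cmp k n
... | tri< k<n _ _ = combine-bounds {P n (suc k)} {P n k} {kpow (suc k)} {2 ^ n} {B⁻ (suc n) (suc k)}
                       (P+B⁻≤B⁺ n (suc k) k<n) (P+B⁻≤B⁺ n k k≤n) (recurrence-slack k<n)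
... | tri≈ _ refl _ = ≤-reflexive (diagonal-edge k)
... | tri> _ _ k>n = contradiction k≤n (<⇒≱ k>n)

B≡B⁺-B⁻ : ∀ n k → B n k ≡ + B⁺ n k ℤ.- + B⁻ n k
B≡B⁺-B⁻ n k = begin
  + x ℤ.+ + 2 ^ (n + 1) ℤ.- + q ℤ.- + 2 ^ k ℤ.- + e  ≡⟨ cong (λ m → + x ℤ.+ + 2 ^ m ℤ.- + q ℤ.- + 2 ^ k ℤ.- + e) (+-comm n 1) ⟩
  + x ℤ.+ + y ℤ.- + q ℤ.- + 2 ^ k ℤ.- + e            ≡⟨ regroup (+ x) (+ y) (+ q) (+ 2 ^ k) (+ e) ⟩
  (+ x ℤ.+ + y) ℤ.- (+ q ℤ.+ + 2 ^ k ℤ.+ + e)         ≡⟨ cong₂ ℤ._-_ (ℤ.pos-+ x y) (trans (ℤ.pos-+ (q + 2 ^ k) e) (cong (ℤ._+ + e) (ℤ.pos-+ q (2 ^ k)))) ⟨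
  + B⁺ n k ℤ.- + B⁻ n k                               ∎
  where
  open ≡-Reasoning
  x = pow2m2 n (k * k + k)
  y = 2 ^ suc n
  q = kpow k
  e = 2 ^ (n ∸ k)
  regroup : ∀ x y q w e → x ℤ.+ y ℤ.- q ℤ.- w ℤ.- e ≡ (x ℤ.+ y) ℤ.- (q ℤ.+ w ℤ.+ e)
  regroup = ℤSolver.solve-∀

+m≤+n-+o : ∀ {m n o} → m + o ≤ₙ n → + m ≤ + n ℤ.- + o
+m≤+n-+o {m} {n} {o} m+o≤n
  rewrite ℤ.m-n≡m⊖n n o | ℤ.⊖-≥ (m+n≤o⇒n≤o m m+o≤n) = ℤ.+≤+ (m+n≤o⇒m≤o∸n m m+o≤n)

mainTheorem10 : (n k : ℕ) → k < n → + P n k ≤ B n k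
mainTheorem10 n k k<n = subst (+ P n k ≤_) (sym (B≡B⁺-B⁻ n k)) (+m≤+n-+o (P+B⁻≤B⁺ n k (<⇒≤ k<n)))
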